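{- Let $(H,k,\chi)$ be an instance of Precoloring Extension where $H$ has at least one edge, and consider the $P_n\,|\,\mathrm{conc}\,|\,\sum C_j$ instance constructed from it as described in the context. Let $C$ be a minimal feasible schedule for it, let $j\in V_0$ with $\chi(j)>1$, and let $J$ be the set of lower bound jobs of $j$. Then $\sum_{i\in J}C_i\ge(\ell_j-1)\cdot X$. Moreover, if $C(j)<\ell_j$, then $\sum_{i\in J}C_i\ge \ell_j\cdot X$.
   Context: Precoloring Extension instance: graph $H=(V,F)$, $V=\{1,\ldots,n\}$, integer $k$, and a proper coloring $\chi:V_0\to\{1,\ldots,k\}$ of $H[V_0]$, $V_0\subseteq V$. Scheduling: jobs with positive integer processing times $p_j$, release times $0$, conflict graph $G$; a schedule $C$ (completion times in $\mathbb{N}$) is feasible if $C_j-p_j\ge0$ for every job and $[C_i-p_i,C_i)\cap[C_j-p_j,C_j)=\emptyset$ for every edge $\{i,j\}$ of $G$; it is minimal if decreasing the completion time of any single job by any positive amount makes it infeasible. Construction: let $X=nk+1$; start with $G=H$, $p_j=1$ for $j\in V$. Let $u_j=\chi(j)$ for $j\in V_0$ and $u_j=k$ otherwise; $\ell_j=\chi(j)$ for $j\in V_0$ and $\ell_j=1$ otherwise. For each $j\in V$: add primary upper bound jobs $j(1),\ldots,j(X)$, each with processing time $X-u_j$, and edges $\{j,j(i)\}$; for each $i\in\{1,\ldots,X\}$ add secondary upper bound jobs $j(i,1),\ldots,j(i,X)$, each with processing time $u_j$, and edges $\{j(i),j(i,i_0)\}$. For each $j\in V_0$ with $\chi(j)>1$: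 add lower bound jobs $j^*(1),\ldots,j^*(X)$, each with processing time $\ell_j-1$, and edges $\{j,j^*(i)\}$; these are the lower bound jobs of $j$. No other edges are added. -}

module Defs where

open import Data.Nat using (ℕ; zero; suc; _+_; _*_; _∸_; _≤_; _<_)
open import Data.Fin using (Fin)
open import Data.Maybe using (Maybe; just; nothing)
open import Data.Product using (Σ; ∃; _×_; _,_)
open import Data.Sum using (_⊎_)
open import Data.Empty using (⊥)
open import Relation.Nullary using (¬_)
open import Relation.Binary.PropositionalEquality using (_≡_; _≢_)

-- A finite simple graph on vertex set Fin n (vertex i stands for i+1).
record Graph (n : ℕ) : Set₁ where
  field
    Adj   : Fin n → Fin n → Set
    sym   : ∀ {i j} → Adj i j → Adj j i
    irrefl : ∀ {i} → ¬ Adj i i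

open Graph public

HasEdge : ∀ {n} → Graph n → Set
HasEdge {n} H = Σ (Fin n) λ i → Σ (Fin n) λ j → Adj H i j

-- A precoloring χ : V₀ → {1..k}, V₀ = {j | col j ≡ just c}, proper on H[V₀].
record Precoloring {n : ℕ} (H : Graph n) (k : ℕ) : Set where
  field
    col     : Fin n → Maybe ℕ
    inRange : ∀ j c → col j ≡ just c → 1 ≤ c × c ≤ k
    proper  : ∀ i j c → Adj H i j → col i ≡ just c → col j ≡ just c → ⊥

open Precoloring public

bigX : ℕ → ℕ → ℕ
bigX n k = n * k + 1

uBound : ℕ → Maybe ℕ → ℕ
uBound k (just c) = c
uBound k nothing  = k

lBound : Maybe ℕ → ℕ
lBound (just c) = c
lBound nothing  = 1

-- j ∈ V₀ and χ(j) > 1 : exactly the vertices having lower bound jobs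
HasLow : ∀ {n} → (Fin n → Maybe ℕ) → Fin n → Set
HasLow χ j = Σ ℕ λ c → χ j ≡ just c × 1 < c

data Job (n X : ℕ) (χ : Fin n → Maybe ℕ) : Set where
  orig : Fin n → Job n X χ
  prim : Fin n → Fin X → Job n X χ
  sec  : Fin n → Fin X → Fin X → Job n X χ
  low  : (j : Fin n) → Fin X → HasLow χ j → Job n X χ

module Instance {n k : ℕ} (H : Graph n) (χ : Precoloring H k) where

  X : ℕ
  X = bigX n k

  J : Set
  J = Job n X (col χ)

  u ℓ : Fin n → ℕ
  u j = uBound k (col χ j)
  ℓ j = lBound (col χ j)

  p : J → ℕ
  p (orig j)     = 1
  p (prim j i)   = X ∸ u j
  p (sec j i i₀) = u j
  p (low j i _)  = ℓ j ∸ 1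

  -- edges added by the construction, in one orientation
  E : J → J → Set
  E (orig i)     (orig j)       = Adj H i j
  E (orig j)     (prim j' i)    = j ≡ j'
  E (prim j i)   (sec j' i' i₀) = j ≡ j' × i ≡ i'
  E (orig j)     (low j' i _)   = j ≡ j'
  E _            _              = ⊥

  Conf : J → J → Set
  Conf a b = E a b ⊎ E b a

  InInterval : (J → ℕ) → J → ℕ → Set
  InInterval C a t = C a ∸ p a ≤ t × t < C a

  Feasible : (J → ℕ) → Set
  Feasible C = (∀ a → p a ≤ C a)
             × (∀ a b → Conf a b → ∀ t → ¬ (InInterval C a t × InInterval C b t))

  Minimal : (J → ℕ) → Set
  Minimal C = ∀ (a : J) (C' : J → ℕ) → (∀ b → b ≢ a → C' b ≡ C b) → C' a < C a → ¬ Feasible C'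

  MinimalFeasible : (J → ℕ) → Set
  MinimalFeasible C = Feasible C × Minimal C

-- Every lower bound job j*(i) has length ℓ_j − 1, so C ≥ ℓ_j − 1 on each of the X of them.
-- If moreover C(j) < ℓ_j, a lower bound job with C < ℓ_j would occupy [0, C), which contains
-- the last slot C(j) − 1 of the unit job j it conflicts with; hence each has C ≥ ℓ_j.
module Submission where

open import Defs
open import Data.Nat using (ℕ; _*_; _∸_; _≥_; _<_; _≤_; z≤n; s≤s; _≤?_)
open import Data.Nat.Properties
  using (+-mono-≤; *-comm; <-≤-trans; <⇒≤pred; ≰⇒>; ∸-monoʳ-≤; ∸-monoʳ-<; m≤n⇒m∸n≡0; ∸-monoˡ-<)
open import Data.Fin using (Fin)
open import Data.List using (List; []; _∷_; map; allFin; length)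
open import Data.List.Properties using (length-tabulate)
open import Data.Nat.ListAction using (sum)
open import Data.Product using (_×_; _,_)
open import Data.Sum using (inj₁)
open import Relation.Binary.PropositionalEquality using (refl; trans; subst; cong)
open import Relation.Nullary using (yes; no)
open import Data.Empty using (⊥-elim)

sum-map-≥ : ∀ {A : Set} (f : A → ℕ) {m : ℕ} (xs : List A) →
            (∀ x → m ≤ f x) → length xs * m ≤ sum (map f xs)
sum-map-≥ f []       _   = z≤n
sum-map-≥ f (x ∷ xs) m≤f = +-mono-≤ (m≤f x) (sum-map-≥ f xs m≤f)

sum-allFin-≥ : ∀ {X m : ℕ} (f : Fin X → ℕ) → (∀ i → m ≤ f i) → sum (map f (allFin X)) ≥ m * X
sum-allFin-≥ {X} {m} f m≤f =
  subst (_≤ sum (map f (allFin X)))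
        (trans (cong (_* m) (length-tabulate {A = Fin X} (λ i → i))) (*-comm X m))
        (sum-map-≥ f (allFin X) m≤f)

module _ {n k : ℕ} (H : Graph n) (χ : Precoloring H k) where
  open Instance H χ

  inInterval-lastSlot : ∀ C a → 1 ≤ p a → 1 ≤ C a → InInterval C a (C a ∸ 1)
  inInterval-lastSlot C a 1≤p 1≤C = ∸-monoʳ-≤ (C a) 1≤p , ∸-monoʳ-< (s≤s z≤n) 1≤C

  inInterval-fromZero : ∀ C a {t} → C a ≤ p a → t < C a → InInterval C a t
  inInterval-fromZero C a C≤p t<C rewrite m≤n⇒m∸n≡0 C≤p = z≤n , t<C

  low-≥ℓ : ∀ C → Feasible C → ∀ j i (h : HasLow (col χ) j) →
           C (orig j) < ℓ j → ℓ j ≤ C (low j i h)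
  low-≥ℓ C (p≤C , disjoint) j i h Cj<ℓ with ℓ j ≤? C (low j i h)
  ... | yes ℓ≤C = ℓ≤C
  ... | no  ℓ≰C = ⊥-elim (disjoint (orig j) (low j i h) (inj₁ refl) (C (orig j) ∸ 1)
                    ( inInterval-lastSlot C (orig j) (s≤s z≤n) (p≤C (orig j))
                    , inInterval-fromZero C (low j i h) (<⇒≤pred (≰⇒> ℓ≰C))
                        (<-≤-trans (∸-monoˡ-< Cj<ℓ (p≤C (orig j))) (p≤C (low j i h)))))

lemma13 : ∀ {n k : ℕ} (H : Graph n) (χ : Precoloring H k) → HasEdge H →
          (C : Instance.J H χ → ℕ) → Instance.MinimalFeasible H χ C →
          (j : Fin n) (h : HasLow (col χ) j) →
          (sum (map (λ i → C (low j i h)) (allFin (Instance.X H χ))) ≥ (Instance.ℓ H χ j ∸ 1) * Instance.X H χ)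
          × (C (orig j) < Instance.ℓ H χ j →
             sum (map (λ i → C (low j i h)) (allFin (Instance.X H χ))) ≥ Instance.ℓ H χ j * Instance.X H χ)
lemma13 H χ _ C (feasible@(p≤C , _) , _) j h =
    sum-allFin-≥ _ (λ i → p≤C (low j i h))
  , λ Cj<ℓ → sum-allFin-≥ _ (λ i → low-≥ℓ H χ C feasible j i h Cj<ℓ)
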